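{- There is no connected $C_3$-free finite simple graph $G$ with minimum degree $\delta(G)>1$ such that the $2$-shunt intersection graph $A_2(G)$ has the same number of vertices as $G$.
   Context: A $2$-arc on distinct vertices is a sequence $(x,u,y)$ of pairwise distinct vertices with $xu,uy\in E(G)$; it can be shunted onto $(u,y,z)$ if $x,u,y,z$ are pairwise distinct and $yz\in E(G)$. $A_2(G)$ has as vertices the $2$-arcs on distinct vertices that can be shunted onto some other $2$-arc on distinct vertices; two distinct vertices are adjacent iff the corresponding $2$-arcs share a vertex of $G$. -}

module Defs where

open import Data.Nat using (ℕ; _≤_)
open import Data.Fin using (Fin; _≟_)
open import Data.Bool using (Bool; true; false; _∧_; not)
open import Data.List using (List; allFin; filterᵇ; length; cartesianProduct)
open import Data.Bool.ListAction using (any)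
open import Data.Product using (_×_; _,_)
open import Data.Empty using (⊥)
open import Relation.Nullary using (does)
open import Relation.Binary.PropositionalEquality using (_≡_)

record Graph (n : ℕ) : Set where
  field
    adj    : Fin n → Fin n → Bool
    sym    : ∀ x y → adj x y ≡ adj y x
    irrefl : ∀ x → adj x x ≡ false
open Graph public

module _ {n : ℕ} (G : Graph n) where

  E : Fin n → Fin n → Set
  E x y = adj G x y ≡ true

  data Reach : Fin n → Fin n → Set where
    here : ∀ {x} → Reach x x
    step : ∀ {x y z} → E x y → Reach y z → Reach x z

  Connected : Set
  Connected = ∀ x y → Reach x y

  C3Free : Set
  C3Free = ∀ x y z → E x y → E y z → E z x → ⊥

  degree : Fin n → ℕ
  degree v = length (filterᵇ (adj G v) (allFin n))

  neq : Fin n → Fin n → Bool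
  neq a b = not (does (a ≟ b))

  is2Arc : Fin n → Fin n → Fin n → Bool
  is2Arc x u y = neq x u ∧ neq u y ∧ neq x y ∧ adj G x u ∧ adj G u y

  -- (x,u,y) can be shunted onto (u,y,z) for some z:
  -- x,u,y,z pairwise distinct and yz ∈ E(G)
  shuntable : Fin n → Fin n → Fin n → Bool
  shuntable x u y = any (λ z → neq z x ∧ neq z u ∧ neq z y ∧ adj G y z) (allFin n)

  isA2Vertex : Fin n × (Fin n × Fin n) → Bool
  isA2Vertex (x , u , y) = is2Arc x u y ∧ shuntable x u y

  numA2Vertices : ℕ
  numA2Vertices =
    length (filterᵇ isA2Vertex
      (cartesianProduct (allFin n) (cartesianProduct (allFin n) (allFin n))))

-- Every vertex x of such a graph is the tail of at least two vertices of
-- A₂(G): take two distinct neighbours u₁, u₂ of x, a neighbour yᵢ ≠ x of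
-- each uᵢ, and a neighbour z ≠ uᵢ of yᵢ. Triangle-freeness makes
-- x, uᵢ, yᵢ, z pairwise distinct, so (x, uᵢ, yᵢ) is a shuntable 2-arc.
-- Hence |V(A₂(G))| ≥ 2n > n.
module Submission where

open import Defs hiding (sym)
open import Data.Nat using (ℕ; suc; _≤_; _+_; _*_; z≤n; s≤s)
open import Data.Nat.Properties using (≤-trans; ≤-reflexive; n≤1+n; +-mono-≤; <-irrefl; m<m*n; module ≤-Reasoning)
open import Data.Fin using (_≟_)
open import Data.Bool using (Bool; true; _∧_; T)
open import Data.Bool.Properties using (T-≡; T?)
open import Data.List using (List; []; _∷_; _++_; map; allFin; filterᵇ; length; cartesianProduct)
open import Data.List.Properties using (filter-++; length-++; length-tabulate)
open import Data.List.Membership.Propositional using (_∈_; lose)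
open import Data.List.Membership.Propositional.Properties using (∈-allFin; ∈-filter⁺; ∈-filter⁻; ∈-map⁺; ∈-cartesianProduct⁺)
open import Data.List.Relation.Unary.Any using (here; there)
open import Data.List.Relation.Unary.Any.Properties using (any⁺)
open import Data.List.Relation.Unary.All using (_∷_)
open import Data.List.Relation.Unary.AllPairs using (_∷_)
open import Data.List.Relation.Unary.Unique.Propositional using (Unique)
open import Data.List.Relation.Unary.Unique.Propositional.Properties using (allFin⁺; filter⁺)
open import Data.Product using (_×_; _,_; ∃-syntax)
open import Function using (Equivalence; _∘_)
open import Relation.Nullary using (¬_; yes; no; contradiction)
open import Relation.Binary.Definitions using (DecidableEquality)
open import Relation.Binary.PropositionalEquality using (_≡_; _≢_; refl; trans; sym; cong)

∧-intro : ∀ {a b} → T a → T b → T (a ∧ b)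
∧-intro {true} _ tb = tb

module _ {A : Set} where

  ∈⇒1≤length : ∀ {a : A} {xs} → a ∈ xs → 1 ≤ length xs
  ∈⇒1≤length (here _)  = s≤s z≤n
  ∈⇒1≤length (there _) = s≤s z≤n

  distinct-∈⇒2≤length : ∀ {a b : A} {xs} → a ∈ xs → b ∈ xs → a ≢ b → 2 ≤ length xs
  distinct-∈⇒2≤length (here refl) (here refl) a≢b = contradiction refl a≢b
  distinct-∈⇒2≤length (here _)  (there b∈) _ = s≤s (∈⇒1≤length b∈)
  distinct-∈⇒2≤length (there a∈) (here _)  _ = s≤s (∈⇒1≤length a∈)
  distinct-∈⇒2≤length (there a∈) (there b∈) a≢b = ≤-trans (distinct-∈⇒2≤length a∈ b∈ a≢b) (n≤1+n _)

  unique-2≤length⇒∃≢ : DecidableEquality A → ∀ {xs} → Unique xs → 2 ≤ length xs →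
                       ∀ c → ∃[ y ] y ∈ xs × y ≢ c
  unique-2≤length⇒∃≢ _ {_ ∷ []} _ (s≤s ()) _
  unique-2≤length⇒∃≢ _≟ᴬ_ {a ∷ b ∷ _} ((a≢b ∷ _) ∷ _) _ c with a ≟ᴬ c
  ... | no a≢c    = a , here refl , a≢c
  ... | yes refl  = b , there (here refl) , a≢b ∘ sym

module _ {X Y : Set} (P : X × Y → Bool) where

  length-filter-cartesianProduct-≥ : ∀ {k} (xs : List X) (ys : List Y) →
    (∀ x → k ≤ length (filterᵇ P (map (x ,_) ys))) →
    length xs * k ≤ length (filterᵇ P (cartesianProduct xs ys))
  length-filter-cartesianProduct-≥ []       ys h = z≤n
  length-filter-cartesianProduct-≥ {k} (x ∷ xs) ys h = begin
    k + length xs * k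
      ≤⟨ +-mono-≤ (h x) (length-filter-cartesianProduct-≥ xs ys h) ⟩
    length (filterᵇ P row) + length (filterᵇ P rest)
      ≡⟨ length-++ (filterᵇ P row) ⟨
    length (filterᵇ P row ++ filterᵇ P rest)
      ≡⟨ cong length (filter-++ (T? ∘ P) row rest) ⟨
    length (filterᵇ P (cartesianProduct (x ∷ xs) ys))
      ∎
    where
    open ≤-Reasoning
    row  = map (x ,_) ys
    rest = cartesianProduct xs ys

module _ {n : ℕ} (G : Graph n) where

  E⇒T : ∀ {a b} → E G a b → T (adj G a b)
  E⇒T = Equivalence.from T-≡

  E⇒≢ : ∀ {a b} → E G a b → a ≢ b
  E⇒≢ {a} e refl with trans (sym e) (irrefl G a)
  ... | ()

  ≢⇒neq : ∀ {a b} → a ≢ b → T (neq G a b)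
  ≢⇒neq {a} {b} a≢b with a ≟ b
  ... | yes a≡b = contradiction a≡b a≢b
  ... | no _    = _

  neighbour-≢ : (∀ v → 2 ≤ degree G v) → ∀ v c → ∃[ y ] E G v y × y ≢ c
  neighbour-≢ δ≥2 v c with unique-2≤length⇒∃≢ _≟_ (filter⁺ (T? ∘ adj G v) (allFin⁺ n)) (δ≥2 v) c
  ... | y , y∈ , y≢c with ∈-filter⁻ (T? ∘ adj G v) {xs = allFin n} y∈
  ... | _ , T-vy = y , Equivalence.to T-≡ T-vy , y≢c

  path⇒A2Vertex : C3Free G → ∀ {x u y z} → E G x u → E G u y → y ≢ x → E G y z → z ≢ u →
                  T (isA2Vertex G (x , u , y))
  path⇒A2Vertex noC3 {x} {u} {y} {z} xu uy y≢x yz z≢u =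
    ∧-intro (∧-intro (≢⇒neq (E⇒≢ xu)) (∧-intro (≢⇒neq (E⇒≢ uy)) (∧-intro (≢⇒neq (y≢x ∘ sym))
              (∧-intro (E⇒T xu) (E⇒T uy)))))
            (any⁺ _ (lose (∈-allFin z)
              (∧-intro (≢⇒neq z≢x) (∧-intro (≢⇒neq z≢u) (∧-intro (≢⇒neq (E⇒≢ yz ∘ sym)) (E⇒T yz))))))
    where
    z≢x : z ≢ x
    z≢x refl = noC3 x u y xu uy yz

  module _ (noC3 : C3Free G) (δ≥2 : ∀ v → 2 ≤ degree G v) where

    edge⇒A2Vertex : ∀ {x u} → E G x u → ∃[ y ] T (isA2Vertex G (x , u , y))
    edge⇒A2Vertex {x} {u} xu with neighbour-≢ δ≥2 u x
    ... | y , uy , y≢x with neighbour-≢ δ≥2 y u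
    ... | z , yz , z≢u = y , path⇒A2Vertex noC3 xu uy y≢x yz z≢u

    A2Vertices-with-tail-≥2 : ∀ x →
      2 ≤ length (filterᵇ (isA2Vertex G) (map (x ,_) (cartesianProduct (allFin n) (allFin n))))
    A2Vertices-with-tail-≥2 x with neighbour-≢ δ≥2 x x
    ... | u₁ , xu₁ , _ with neighbour-≢ δ≥2 x u₁
    ... | u₂ , xu₂ , u₂≢u₁ with edge⇒A2Vertex xu₁ | edge⇒A2Vertex xu₂
    ... | y₁ , A₁ | y₂ , A₂ =
      distinct-∈⇒2≤length (tail∈ u₁ y₁ A₁) (tail∈ u₂ y₂ A₂) λ { refl → u₂≢u₁ refl }
      where
      tail∈ : ∀ u y → T (isA2Vertex G (x , u , y)) → (x , u , y) ∈
        filterᵇ (isA2Vertex G) (map (x ,_) (cartesianProduct (allFin n) (allFin n)))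
      tail∈ u y = ∈-filter⁺ (T? ∘ isA2Vertex G) (∈-map⁺ (x ,_) (∈-cartesianProduct⁺ (∈-allFin u) (∈-allFin y)))

    numA2Vertices-≥2n : n * 2 ≤ numA2Vertices G
    numA2Vertices-≥2n = ≤-trans (≤-reflexive (cong (_* 2) (sym (length-tabulate {n = n} (λ i → i)))))
      (length-filter-cartesianProduct-≥ (isA2Vertex G) (allFin n) (cartesianProduct (allFin n) (allFin n))
        A2Vertices-with-tail-≥2)

mainTheorem17 : (n : ℕ) → (G : Graph n) → 1 ≤ n → Connected G → C3Free G →
    (∀ v → 2 ≤ degree G v) → ¬ (numA2Vertices G ≡ n)
mainTheorem17 n@(suc _) G (s≤s z≤n) _ noC3 δ≥2 |A₂|≡n =
  <-irrefl refl (≤-trans (m<m*n n 2 (s≤s (s≤s z≤n)))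
                         (≤-trans (numA2Vertices-≥2n G noC3 δ≥2) (≤-reflexive |A₂|≡n)))
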